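{- Let $\langle A,N\rangle$ be a complete Leibniz N4-structure with truth-value assignment $\|\cdot\|$ as in the context. Then for every formula $\varphi(x)$ and every $u\in\mathbf{V}^{\langle A,N\rangle}$, $$\|\exists x\,(x\in u\wedge\varphi(x))\|=\bigvee_{x\in dom(u)}(u(x)\wedge\|\varphi(x)\|),\qquad \|\forall x\,(x\in u\to\varphi(x))\|=\bigwedge_{x\in dom(u)}(u(x)\to\|\varphi(x)\|).$$
   Context: An N4-structure is $\langle A,\{N_x\}_{x\in A}\rangle$ where $A$ is a generalized Heyting algebra (distributive lattice with top $1$ and $\to$ with $x\wedge y\leq z$ iff $x\leq y\to z$) and $N_x\subseteq A$ with: (i) $N_x\neq\emptyset$; (ii) for $x'\in N_x,y'\in N_y$: $x'\vee y'\in N_{x\wedge y}$, $x'\wedge y'\in N_{x\vee y}$, $x\in N_{x'}$; (iii) for $y'\in N_y$: $x\wedge y'\in N_{x\to y}$. It is complete if $A$ is a complete lattice. Fix a model $\mathbf V$ of set theory; $\mathbf{V}^{\langle A,N\rangle}_\xi=\{x: x$ a function, $ran(x)\subseteq A$, $dom(x)\subseteq\mathbf{V}^{\langle A,N\rangle}_\zeta$ for some $\zeta<\xi\}$, $\mathbf{V}^{\langle A,N\rangle}=\bigcup_\xi\mathbf{V}^{\langle A,N\rangle}_\xi$. $\mathcal{L}_{\langle A,N\rangle}$ is the first-order language with connectives $\to,\wedge,\vee,\neg$, predicates $\in,\approx$, and constants for all names. A truth-value assignment is a map $\|\cdot\|$ from closed formulas to $A$ with: $\|u\in v\|=\bigvee_{x\in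 dom(v)}(v(x)\wedge\|x\approx u\|)$; $\|u\approx v\|=\bigwedge_{x\in dom(u)}(u(x)\to\|x\in v\|)\wedge\bigwedge_{x\in dom(v)}(v(x)\to\|x\in u\|)$; $\|\varphi\#\psi\|=\|\varphi\|\#\|\psi\|$ for $\#\in\{\wedge,\vee,\to\}$; $\|\neg\varphi\|\in N_{\|\varphi\|}$, $\|\neg\neg\varphi\|=\|\varphi\|$; $\|\neg(\varphi\vee\psi)\|=\|\neg\varphi\|\wedge\|\neg\psi\|$; $\|\neg(\varphi\wedge\psi)\|=\|\neg\varphi\|\vee\|\neg\psi\|$; $\|\neg(\varphi\to\psi)\|=\|\varphi\|\wedge\|\neg\psi\|$; $\|\exists x\varphi\|=\bigvee_{u}\|\varphi(u)\|$, $\|\forall x\varphi\|=\bigwedge_u\|\varphi(u)\|$ over $u\in\mathbf{V}^{\langle A,N\rangle}$; and $\|u\approx v\|\leq\|\neg\phi(u)\|\to\|\neg\phi(v)\|$ for every formula $\phi$. The structure is called Leibniz if moreover $\|u\approx v\|\leq\|\phi(u)\|\to\|\phi(v)\|$ for all names $u,v$ and all formulas $\phi$. -}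

module Defs where

open import Level using (Lift; lift; lower; 0ℓ) renaming (suc to lsuc)
open import Data.Nat using (ℕ; zero; suc)
open import Data.Fin using (Fin; zero; suc)
open import Data.Product using (Σ; _×_; _,_)
open import Relation.Binary.PropositionalEquality using (_≡_)

-- A partial order with top, binary meets/joins, relative pseudo-complement
-- (x ∧ y ≤ z  iff  x ≤ y ⇒ z), and arbitrary meets/joins of families
-- indexed by types in Set₁ (the carrier itself lives in Set₁, so this is
-- completeness w.r.t. all subsets at the carrier's level).
-- Distributivity follows from the residuation law.

record CompleteGHA : Set₂ where
  infixr 7 _∧_
  infixr 6 _∨_
  infixr 5 _⇒_
  infix 4 _≤_
  field
    Carrier   : Set₁
    _≤_       : Carrier → Carrier → Set₁
    ≤-refl    : ∀ {x} → x ≤ x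
    ≤-trans   : ∀ {x y z} → x ≤ y → y ≤ z → x ≤ z
    ≤-antisym : ∀ {x y} → x ≤ y → y ≤ x → x ≡ y
    ⊤         : Carrier
    ≤-⊤       : ∀ {x} → x ≤ ⊤
    _∧_       : Carrier → Carrier → Carrier
    ∧-lb₁     : ∀ {x y} → x ∧ y ≤ x
    ∧-lb₂     : ∀ {x y} → x ∧ y ≤ y
    ∧-glb     : ∀ {x y z} → z ≤ x → z ≤ y → z ≤ x ∧ y
    _∨_       : Carrier → Carrier → Carrier
    ∨-ub₁     : ∀ {x y} → x ≤ x ∨ y
    ∨-ub₂     : ∀ {x y} → y ≤ x ∨ y
    ∨-lub     : ∀ {x y z} → x ≤ z → y ≤ z → x ∨ y ≤ z
    _⇒_       : Carrier → Carrier → Carrier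
    residual  : ∀ {x y z} → x ∧ y ≤ z → x ≤ y ⇒ z
    residual⁻ : ∀ {x y z} → x ≤ y ⇒ z → x ∧ y ≤ z
    ⋁         : {I : Set₁} → (I → Carrier) → Carrier
    ⋁-ub      : ∀ {I : Set₁} (f : I → Carrier) (i : I) → f i ≤ ⋁ f
    ⋁-lub     : ∀ {I : Set₁} (f : I → Carrier) {z} → (∀ i → f i ≤ z) → ⋁ f ≤ z
    ⋀         : {I : Set₁} → (I → Carrier) → Carrier
    ⋀-lb      : ∀ {I : Set₁} (f : I → Carrier) (i : I) → ⋀ f ≤ f i
    ⋀-glb     : ∀ {I : Set₁} (f : I → Carrier) {z} → (∀ i → z ≤ f i) → z ≤ ⋀ f

module Lang (A : CompleteGHA) where
  open CompleteGHA A

  -- N4-structure on A: N x a  means  a ∈ N_x.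
  record IsN4 (N : Carrier → Carrier → Set₁) : Set₁ where
    field
      nonempty : ∀ x → Σ Carrier (N x)
      ∨∈N∧     : ∀ {x y x' y'} → N x x' → N y y' → N (x ∧ y) (x' ∨ y')
      ∧∈N∨     : ∀ {x y x' y'} → N x x' → N y y' → N (x ∨ y) (x' ∧ y')
      invol    : ∀ {x x'} → N x x' → N x' x
      impl     : ∀ {x y y'} → N y y' → N (x ⇒ y) (x ∧ y')

  data Name : Set₁ where
    mkName : (D : Set) → (D → Name) → (D → Carrier) → Name

  Dom : Name → Set
  Dom (mkName D _ _) = D

  elt : (u : Name) → Dom u → Name
  elt (mkName _ e _) = e

  val : (u : Name) → Dom u → Carrier
  val (mkName _ _ v) = v

  ⋁ᵈ : (u : Name) → (Dom u → Carrier) → Carrier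
  ⋁ᵈ u f = ⋁ {Lift (lsuc 0ℓ) (Dom u)} (λ i → f (lower i))

  ⋀ᵈ : (u : Name) → (Dom u → Carrier) → Carrier
  ⋀ᵈ u f = ⋀ {Lift (lsuc 0ℓ) (Dom u)} (λ i → f (lower i))

  data Term (n : ℕ) : Set₁ where
    var : Fin n → Term n
    con : Name → Term n

  infix 9 _∈'_ _≈'_
  infixr 7 _∧'_
  infixr 6 _∨'_
  infixr 5 _⇒'_
  data Formula (n : ℕ) : Set₁ where
    _∈'_ _≈'_       : Term n → Term n → Formula n
    _∧'_ _∨'_ _⇒'_  : Formula n → Formula n → Formula n
    ¬'_             : Formula n → Formula n
    ∃' ∀'           : Formula (suc n) → Formula n

  wkT : ∀ {n} → Term n → Term (suc n)
  wkT (var i) = var (suc i)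
  wkT (con u) = con u

  liftS : ∀ {n m} → (Fin n → Term m) → Fin (suc n) → Term (suc m)
  liftS σ zero    = var zero
  liftS σ (suc i) = wkT (σ i)

  substT : ∀ {n m} → (Fin n → Term m) → Term n → Term m
  substT σ (var i) = σ i
  substT σ (con u) = con u

  subst : ∀ {n m} → (Fin n → Term m) → Formula n → Formula m
  subst σ (s ∈' t) = substT σ s ∈' substT σ t
  subst σ (s ≈' t) = substT σ s ≈' substT σ t
  subst σ (φ ∧' ψ) = subst σ φ ∧' subst σ ψ
  subst σ (φ ∨' ψ) = subst σ φ ∨' subst σ ψ
  subst σ (φ ⇒' ψ) = subst σ φ ⇒' subst σ ψ
  subst σ (¬' φ)   = ¬' subst σ φ
  subst σ (∃' φ)   = ∃' (subst (liftS σ) φ)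
  subst σ (∀' φ)   = ∀' (subst (liftS σ) φ)

  _[_] : Formula 1 → Name → Formula 0
  φ [ u ] = subst (λ _ → con u) φ

  record IsTVA (N : Carrier → Carrier → Set₁) (‖_‖ : Formula 0 → Carrier) : Set₁ where
    field
      tv-∈   : ∀ u v → ‖ con u ∈' con v ‖
                 ≡ ⋁ᵈ v (λ x → val v x ∧ ‖ con (elt v x) ≈' con u ‖)
      tv-≈   : ∀ u v → ‖ con u ≈' con v ‖
                 ≡ ⋀ᵈ u (λ x → val u x ⇒ ‖ con (elt u x) ∈' con v ‖)
                   ∧ ⋀ᵈ v (λ x → val v x ⇒ ‖ con (elt v x) ∈' con u ‖)
      tv-∧   : ∀ φ ψ → ‖ φ ∧' ψ ‖ ≡ ‖ φ ‖ ∧ ‖ ψ ‖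
      tv-∨   : ∀ φ ψ → ‖ φ ∨' ψ ‖ ≡ ‖ φ ‖ ∨ ‖ ψ ‖
      tv-⇒   : ∀ φ ψ → ‖ φ ⇒' ψ ‖ ≡ ‖ φ ‖ ⇒ ‖ ψ ‖
      tv-¬   : ∀ φ → N ‖ φ ‖ ‖ ¬' φ ‖
      tv-¬¬  : ∀ φ → ‖ ¬' ¬' φ ‖ ≡ ‖ φ ‖
      tv-¬∨  : ∀ φ ψ → ‖ ¬' (φ ∨' ψ) ‖ ≡ ‖ ¬' φ ‖ ∧ ‖ ¬' ψ ‖
      tv-¬∧  : ∀ φ ψ → ‖ ¬' (φ ∧' ψ) ‖ ≡ ‖ ¬' φ ‖ ∨ ‖ ¬' ψ ‖
      tv-¬⇒  : ∀ φ ψ → ‖ ¬' (φ ⇒' ψ) ‖ ≡ ‖ φ ‖ ∧ ‖ ¬' ψ ‖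
      tv-∃   : ∀ (φ : Formula 1) → ‖ ∃' φ ‖ ≡ ⋁ (λ (u : Name) → ‖ φ [ u ] ‖)
      tv-∀   : ∀ (φ : Formula 1) → ‖ ∀' φ ‖ ≡ ⋀ (λ (u : Name) → ‖ φ [ u ] ‖)
      tv-¬≈  : ∀ u v (φ : Formula 1) →
                 ‖ con u ≈' con v ‖ ≤ ‖ ¬' (φ [ u ]) ‖ ⇒ ‖ ¬' (φ [ v ]) ‖

  IsLeibniz : (‖_‖ : Formula 0 → Carrier) → Set₁
  IsLeibniz ‖_‖ = ∀ u v (φ : Formula 1) →
                    ‖ con u ≈' con v ‖ ≤ ‖ φ [ u ] ‖ ⇒ ‖ φ [ v ] ‖

-- A name u is a bounded quantifier domain: by the truth-value clause for ∈,
-- ‖v ∈ u‖ is the join of u(x) ∧ ‖x ≈ v‖ over x ∈ dom(u), and the Leibniz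
-- condition moves φ along x ≈ v.  So every witness v of ∃x (x ∈ u ∧ φ(x))
-- is dominated by some x ∈ dom(u), while each x ∈ dom(u) is itself a witness
-- because u(x) ≤ ‖x ∈ u‖ (reflexivity of ≈ holds by ∈-induction on names).
-- The bounded universal quantifier is the residuated dual of this argument.
module Submission where

open import Defs
open import Data.Fin using (zero)
open import Data.Product using (_×_; _,_)
open import Level using (lift; lower)
open import Relation.Binary.Bundles using (Poset)
open import Relation.Binary.PropositionalEquality as ≡ using (_≡_; refl)

module HeytingProperties (A : CompleteGHA) where
  open CompleteGHA A

  ≤-reflexive : ∀ {a b} → a ≡ b → a ≤ b
  ≤-reflexive refl = ≤-refl

  poset : Poset _ _ _
  poset = record
    { Carrier        = Carrier
    ; _≈_            = _≡_
    ; _≤_            = _≤_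
    ; isPartialOrder = record
      { isPreorder = record
        { isEquivalence = ≡.isEquivalence
        ; reflexive     = ≤-reflexive
        ; trans         = ≤-trans
        }
      ; antisym    = ≤-antisym
      }
    }

  ∧-mono : ∀ {a b c d} → a ≤ b → c ≤ d → a ∧ c ≤ b ∧ d
  ∧-mono a≤b c≤d = ∧-glb (≤-trans ∧-lb₁ a≤b) (≤-trans ∧-lb₂ c≤d)

  ∧-comm : ∀ {a b} → a ∧ b ≤ b ∧ a
  ∧-comm = ∧-glb ∧-lb₂ ∧-lb₁

  ⇒-eval : ∀ {a b} → (a ⇒ b) ∧ a ≤ b
  ⇒-eval = residual⁻ ≤-refl

  ⇒-antitoneˡ : ∀ {a a′ b} → a′ ≤ a → a ⇒ b ≤ a′ ⇒ b
  ⇒-antitoneˡ a′≤a = residual (≤-trans (∧-mono ≤-refl a′≤a) ⇒-eval)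

  ⋁-∧-distribʳ : ∀ {I : Set₁} (f : I → Carrier) a → ⋁ f ∧ a ≤ ⋁ (λ i → f i ∧ a)
  ⋁-∧-distribʳ f a = residual⁻ (⋁-lub f λ i → residual (⋁-ub (λ j → f j ∧ a) i))

module NameProperties (A : CompleteGHA) where
  open CompleteGHA A
  open Lang A
  open HeytingProperties A
  open import Relation.Binary.Reasoning.PartialOrder poset

  ⋁ᵈ-ub : ∀ u (f : Dom u → Carrier) x → f x ≤ ⋁ᵈ u f
  ⋁ᵈ-ub u f x = ⋁-ub (λ i → f (lower i)) (lift x)

  ⋁ᵈ-lub : ∀ u (f : Dom u → Carrier) {z} → (∀ x → f x ≤ z) → ⋁ᵈ u f ≤ z
  ⋁ᵈ-lub u f f≤z = ⋁-lub (λ i → f (lower i)) λ i → f≤z (lower i)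

  ⋀ᵈ-lb : ∀ u (f : Dom u → Carrier) x → ⋀ᵈ u f ≤ f x
  ⋀ᵈ-lb u f x = ⋀-lb (λ i → f (lower i)) (lift x)

  ⋀ᵈ-glb : ∀ u (f : Dom u → Carrier) {z} → (∀ x → z ≤ f x) → z ≤ ⋀ᵈ u f
  ⋀ᵈ-glb u f z≤f = ⋀-glb (λ i → f (lower i)) λ i → z≤f (lower i)

  ⋁ᵈ-∧-distribʳ : ∀ u (f : Dom u → Carrier) a → ⋁ᵈ u f ∧ a ≤ ⋁ᵈ u (λ x → f x ∧ a)
  ⋁ᵈ-∧-distribʳ u f = ⋁-∧-distribʳ (λ i → f (lower i))

  module _ {N : Carrier → Carrier → Set₁} {‖_‖ : Formula 0 → Carrier}
           (tva : IsTVA N ‖_‖) where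
    open IsTVA tva

    ≈-refl⇒val≤∈ : ∀ u x → ⊤ ≤ ‖ con (elt u x) ≈' con (elt u x) ‖ →
                   val u x ≤ ‖ con (elt u x) ∈' con u ‖
    ≈-refl⇒val≤∈ u x ⊤≤x≈x = begin
      val u x                                          ≤⟨ ∧-glb ≤-refl (≤-trans ≤-⊤ ⊤≤x≈x) ⟩
      val u x ∧ ‖ con (elt u x) ≈' con (elt u x) ‖     ≤⟨ ⋁ᵈ-ub u (λ y → val u y ∧ ‖ con (elt u y) ≈' con (elt u x) ‖) x ⟩
      ⋁ᵈ u (λ y → val u y ∧ ‖ con (elt u y) ≈' con (elt u x) ‖)  ≡⟨ tv-∈ (elt u x) u ⟨
      ‖ con (elt u x) ∈' con u ‖                       ∎

    ≈-refl : ∀ v → ⊤ ≤ ‖ con v ≈' con v ‖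
    ≈-refl v@(mkName _ e _) = begin
      ⊤                                ≤⟨ ∧-glb members≤ members≤ ⟩
      ⋀ᵈ v members ∧ ⋀ᵈ v members      ≡⟨ tv-≈ v v ⟨
      ‖ con v ≈' con v ‖               ∎
      where
      members : Dom v → Carrier
      members x = val v x ⇒ ‖ con (elt v x) ∈' con v ‖

      members≤ : ⊤ ≤ ⋀ᵈ v members
      members≤ = ⋀ᵈ-glb v members λ x →
        residual (≤-trans ∧-lb₂ (≈-refl⇒val≤∈ v x (≈-refl (e x))))

    val≤∈ : ∀ u x → val u x ≤ ‖ con (elt u x) ∈' con u ‖
    val≤∈ u x = ≈-refl⇒val≤∈ u x (≈-refl (elt u x))

    ≈-sym : ∀ v w → ‖ con v ≈' con w ‖ ≤ ‖ con w ≈' con v ‖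
    ≈-sym v w = begin
      ‖ con v ≈' con w ‖  ≡⟨ tv-≈ v w ⟩
      _                   ≤⟨ ∧-comm ⟩
      _                   ≡⟨ tv-≈ w v ⟨
      ‖ con w ≈' con v ‖  ∎

    ∈∧-elim : ∀ u v {a b} →
              (∀ x → (val u x ∧ ‖ con (elt u x) ≈' con v ‖) ∧ a ≤ b) →
              ‖ con v ∈' con u ‖ ∧ a ≤ b
    ∈∧-elim u v {a} {b} step = begin
      ‖ con v ∈' con u ‖ ∧ a                                     ≡⟨ ≡.cong (_∧ a) (tv-∈ v u) ⟩
      ⋁ᵈ u (λ x → val u x ∧ ‖ con (elt u x) ≈' con v ‖) ∧ a      ≤⟨ ⋁ᵈ-∧-distribʳ u _ a ⟩
      ⋁ᵈ u (λ x → (val u x ∧ ‖ con (elt u x) ≈' con v ‖) ∧ a)    ≤⟨ ⋁ᵈ-lub u _ step ⟩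
      b                                                          ∎

    module _ (leib : IsLeibniz ‖_‖) where

      ≈-transport : ∀ (φ : Formula 1) v w → ‖ φ [ v ] ‖ ∧ ‖ con v ≈' con w ‖ ≤ ‖ φ [ w ] ‖
      ≈-transport φ v w = ≤-trans (∧-mono ≤-refl (leib v w φ)) (≤-trans ∧-comm ⇒-eval)

      ∈∧≤⋁ᵈ : ∀ (φ : Formula 1) u v →
              ‖ con v ∈' con u ‖ ∧ ‖ φ [ v ] ‖ ≤ ⋁ᵈ u (λ x → val u x ∧ ‖ φ [ elt u x ] ‖)
      ∈∧≤⋁ᵈ φ u v = ∈∧-elim u v λ x → begin
        (val u x ∧ ‖ con (elt u x) ≈' con v ‖) ∧ ‖ φ [ v ] ‖
          ≤⟨ ∧-glb (≤-trans ∧-lb₁ ∧-lb₁) (∧-glb ∧-lb₂ (≤-trans ∧-lb₁ (≤-trans ∧-lb₂ (≈-sym (elt u x) v)))) ⟩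
        val u x ∧ (‖ φ [ v ] ‖ ∧ ‖ con v ≈' con (elt u x) ‖)
          ≤⟨ ∧-mono ≤-refl (≈-transport φ v (elt u x)) ⟩
        val u x ∧ ‖ φ [ elt u x ] ‖
          ≤⟨ ⋁ᵈ-ub u (λ y → val u y ∧ ‖ φ [ elt u y ] ‖) x ⟩
        ⋁ᵈ u (λ y → val u y ∧ ‖ φ [ elt u y ] ‖)  ∎

      ⋀ᵈ∧∈≤ : ∀ (φ : Formula 1) u v →
              ⋀ᵈ u (λ x → val u x ⇒ ‖ φ [ elt u x ] ‖) ∧ ‖ con v ∈' con u ‖ ≤ ‖ φ [ v ] ‖
      ⋀ᵈ∧∈≤ φ u v = ≤-trans ∧-comm (∈∧-elim u v λ x → begin
        (val u x ∧ ‖ con (elt u x) ≈' con v ‖) ∧ ⋀ᵈ u (λ y → val u y ⇒ ‖ φ [ elt u y ] ‖)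
          ≤⟨ ∧-glb (∧-glb (≤-trans ∧-lb₂ (⋀ᵈ-lb u _ x)) (≤-trans ∧-lb₁ ∧-lb₁)) (≤-trans ∧-lb₁ ∧-lb₂) ⟩
        ((val u x ⇒ ‖ φ [ elt u x ] ‖) ∧ val u x) ∧ ‖ con (elt u x) ≈' con v ‖
          ≤⟨ ∧-mono ⇒-eval ≤-refl ⟩
        ‖ φ [ elt u x ] ‖ ∧ ‖ con (elt u x) ≈' con v ‖
          ≤⟨ ≈-transport φ (elt u x) v ⟩
        ‖ φ [ v ] ‖  ∎)

      bounded-∃ : ∀ (φ : Formula 1) u →
                  ‖ ∃' (var zero ∈' con u ∧' φ) ‖ ≡ ⋁ᵈ u (λ x → val u x ∧ ‖ φ [ elt u x ] ‖)
      bounded-∃ φ u = ≤-antisym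
        (begin
          ‖ ∃' ψ ‖                 ≡⟨ tv-∃ ψ ⟩
          ⋁ (λ v → ‖ ψ [ v ] ‖)    ≤⟨ ⋁-lub _ (λ v → ≤-trans (≤-reflexive (tv-∧ _ _)) (∈∧≤⋁ᵈ φ u v)) ⟩
          ⋁ᵈ u F                   ∎)
        (⋁ᵈ-lub u F λ x → begin
          val u x ∧ ‖ φ [ elt u x ] ‖                         ≤⟨ ∧-mono (val≤∈ u x) ≤-refl ⟩
          ‖ con (elt u x) ∈' con u ‖ ∧ ‖ φ [ elt u x ] ‖      ≡⟨ tv-∧ _ _ ⟨
          ‖ ψ [ elt u x ] ‖                                   ≤⟨ ⋁-ub (λ v → ‖ ψ [ v ] ‖) (elt u x) ⟩
          ⋁ (λ v → ‖ ψ [ v ] ‖)                               ≡⟨ tv-∃ ψ ⟨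
          ‖ ∃' ψ ‖                                            ∎)
        where
        ψ = var zero ∈' con u ∧' φ
        F = λ x → val u x ∧ ‖ φ [ elt u x ] ‖

      bounded-∀ : ∀ (φ : Formula 1) u →
                  ‖ ∀' (var zero ∈' con u ⇒' φ) ‖ ≡ ⋀ᵈ u (λ x → val u x ⇒ ‖ φ [ elt u x ] ‖)
      bounded-∀ φ u = ≤-antisym
        (begin
          ‖ ∀' ψ ‖                 ≡⟨ tv-∀ ψ ⟩
          ⋀ (λ v → ‖ ψ [ v ] ‖)    ≤⟨ ⋀ᵈ-glb u G (λ x → ≤-trans (⋀-lb _ (elt u x)) (instance≤ x)) ⟩
          ⋀ᵈ u G                   ∎)
        (begin
          ⋀ᵈ u G                   ≤⟨ ⋀-glb _ (λ v → ≤-trans (residual (⋀ᵈ∧∈≤ φ u v)) (≤-reflexive (≡.sym (tv-⇒ _ _)))) ⟩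
          ⋀ (λ v → ‖ ψ [ v ] ‖)    ≡⟨ tv-∀ ψ ⟨
          ‖ ∀' ψ ‖                 ∎)
        where
        ψ = var zero ∈' con u ⇒' φ
        G = λ x → val u x ⇒ ‖ φ [ elt u x ] ‖

        instance≤ : ∀ x → ‖ ψ [ elt u x ] ‖ ≤ G x
        instance≤ x = begin
          ‖ ψ [ elt u x ] ‖                                   ≡⟨ tv-⇒ _ _ ⟩
          ‖ con (elt u x) ∈' con u ‖ ⇒ ‖ φ [ elt u x ] ‖      ≤⟨ ⇒-antitoneˡ (val≤∈ u x) ⟩
          G x                                                 ∎

mainTheorem6 : (A : CompleteGHA) →
    let open CompleteGHA A
        open Lang A
    in (N : Carrier → Carrier → Set₁) → IsN4 N →
       (‖_‖ : Formula 0 → Carrier) → IsTVA N ‖_‖ → IsLeibniz ‖_‖ →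
       (φ : Formula 1) (u : Name) →
       (‖ ∃' (var zero ∈' con u ∧' φ) ‖ ≡ ⋁ᵈ u (λ x → val u x ∧ ‖ φ [ elt u x ] ‖))
       × (‖ ∀' (var zero ∈' con u ⇒' φ) ‖ ≡ ⋀ᵈ u (λ x → val u x ⇒ ‖ φ [ elt u x ] ‖))
mainTheorem6 A _ _ _ tva leib φ u = bounded-∃ tva leib φ u , bounded-∀ tva leib φ u
  where open NameProperties A
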